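{- Let $r$ be a positive integer and $n$ a positive integer. Then \[ \Gamma(r)\sum_{k=1}^{n}\frac{h_{k}^{(r)}}{k^{\overline{r}}}=\frac{(H_{n})^{2}+H_{n}^{(2)}}{2}-H_{r-1}\bigl(H_{n+r-1}-H_{n}\bigr)-\bigl(\psi(r)+\gamma\bigr)H_{n}+\sum_{j=1}^{r-1}\frac{H_{j}}{j}+\sum_{j=1}^{r-1}\frac{H_{j-1}}{j+n}. \]
   Context: $\Gamma$ is Euler's gamma function, $\psi=\Gamma'/\Gamma$ the digamma function, $\gamma$ the Euler–Mascheroni constant. $H_n=\sum_{k=1}^n1/k$, $H_n^{(2)}=\sum_{k=1}^n1/k^2$ (with $H_0=0$; empty sums are zero). $k^{\overline{r}}=\Gamma(k+r)/\Gamma(k)$. The hyperharmonic numbers are $h_k^{(0)}=1/k$, $h_k^{(r)}=\sum_{i=1}^k h_i^{(r-1)}$; equivalently $h_{k}^{(r)}=\frac{k^{\overline{r}}}{k\,\Gamma(r)}(\psi(k+r)-\psi(r))$ for $r>0$. -}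

module Defs where

open import Data.Nat as ℕ using (ℕ; zero; suc)
open import Data.Integer using (+_)
open import Data.Rational using (ℚ; 0ℚ; _+_; _*_; _/_)

-- 1/m as a rational for a natural m ≥ 1 (junk value 0 at m = 0; only ever
-- applied to positive arguments below)
recip : ℕ → ℚ
recip zero    = 0ℚ
recip (suc m) = (+ 1) / suc m

ι : ℕ → ℚ
ι m = (+ m) / 1

Σ₁ : ℕ → (ℕ → ℚ) → ℚ
Σ₁ zero    f = 0ℚ
Σ₁ (suc n) f = Σ₁ n f + f (suc n)

H : ℕ → ℚ
H n = Σ₁ n recip

H2 : ℕ → ℚ
H2 n = Σ₁ n (λ k → recip k * recip k)

-- hyperharmonic numbers: h r k = h_k^{(r)}
h : ℕ → ℕ → ℚ
h zero    k = recip k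
h (suc r) k = Σ₁ k (h r)

rising : ℕ → ℕ → ℕ
rising k zero    = 1
rising k (suc r) = rising k r ℕ.* (k ℕ.+ r)

Γℕ : ℕ → ℚ
Γℕ r = ι ((r ℕ.∸ 1) ℕ.!)

-- ψ(r) + γ for a positive integer r, which equals H_{r-1}
ψ+γ : ℕ → ℚ
ψ+γ r = H (r ℕ.∸ 1)

-- With r = s + 1, the closed form s! h_k^{(s+1)} = (k+1)^{\overline s} (H_{k+s} - H_s)
-- turns the summand into (H_{k+s} - H_s)/k.  The sum Σ_{k≤n} H_{k+s}/k is then found by
-- induction on s: for s = 0 it is ((H_n)² + H_n^{(2)})/2, and raising s by one adds
-- Σ_{k≤n} 1/(k(k+s+1)) = (H_n + H_{s+1} - H_{n+s+1})/(s+1), by partial fractions.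
module Submission where

open import Defs
open import Data.Nat as ℕ using (ℕ; zero; suc; _≤_; NonZero; _!)
import Data.Nat.Properties as ℕ
open import Data.Integer as ℤ using (+_)
import Data.Integer.Properties as ℤ
import Data.Integer.Tactic.RingSolver as ℤ-Solver
open import Data.Rational using (ℚ; _+_; _-_; _*_; -_; 0ℚ; 1ℚ; fromℚᵘ)
open import Data.Rational.Properties as ℚ using (+-*-commutativeRing)
open import Data.Rational.Unnormalised as ℚᵘ using (ℚᵘ; mkℚᵘ; *≡*)
import Data.Rational.Unnormalised.Properties as ℚᵘ
import Data.Maybe as Maybe
open import Level using (0ℓ)
open import Algebra.Bundles using (CommutativeMonoid)
open import Algebra.Properties.CommutativeSemigroup
  (CommutativeMonoid.commutativeSemigroup ℚ.+-0-commutativeMonoid)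
  using () renaming (interchange to +-interchange)
open import Relation.Nullary.Decidable using (dec⇒maybe)
open import Relation.Binary.PropositionalEquality
open import Tactic.RingSolver using (solve-∀)
open import Tactic.RingSolver.Core.AlmostCommutativeRing
  using (AlmostCommutativeRing; fromCommutativeRing)

open ≡-Reasoning

ℚ-ring : AlmostCommutativeRing 0ℓ 0ℓ
ℚ-ring = fromCommutativeRing +-*-commutativeRing
  (λ p → Maybe.map sym (dec⇒maybe (p ℚ.≟ 0ℚ)))

fromℚᵘ-homo-+ : ∀ p q → fromℚᵘ (p ℚᵘ.+ q) ≡ fromℚᵘ p + fromℚᵘ q
fromℚᵘ-homo-+ p q = ℚ.toℚᵘ-injective (ℚᵘ.≃-trans (ℚ.toℚᵘ-fromℚᵘ (p ℚᵘ.+ q))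
  (ℚᵘ.≃-sym (ℚᵘ.≃-trans (ℚ.toℚᵘ-homo-+ (fromℚᵘ p) (fromℚᵘ q))
                        (ℚᵘ.+-cong (ℚ.toℚᵘ-fromℚᵘ p) (ℚ.toℚᵘ-fromℚᵘ q)))))

fromℚᵘ-homo-* : ∀ p q → fromℚᵘ (p ℚᵘ.* q) ≡ fromℚᵘ p * fromℚᵘ q
fromℚᵘ-homo-* p q = ℚ.toℚᵘ-injective (ℚᵘ.≃-trans (ℚ.toℚᵘ-fromℚᵘ (p ℚᵘ.* q))
  (ℚᵘ.≃-sym (ℚᵘ.≃-trans (ℚ.toℚᵘ-homo-* (fromℚᵘ p) (fromℚᵘ q))
                        (ℚᵘ.*-cong (ℚ.toℚᵘ-fromℚᵘ p) (ℚ.toℚᵘ-fromℚᵘ q)))))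

-- ι m and recip (suc m) are definitionally fromℚᵘ of the fractions m/1 and 1/(suc m).
ιᵘ : ℕ → ℚᵘ
ιᵘ m = mkℚᵘ (+ m) 0

ι-+ : ∀ m n → ι (m ℕ.+ n) ≡ ι m + ι n
ι-+ m n = trans (ℚ.fromℚᵘ-cong {ιᵘ (m ℕ.+ n)} {ιᵘ m ℚᵘ.+ ιᵘ n}
                  (*≡* (trans (cong (ℤ._* + 1) (ℤ.pos-+ m n)) (numerators (+ m) (+ n)))))
                (fromℚᵘ-homo-+ (ιᵘ m) (ιᵘ n))
  where
  numerators : ∀ a b → (a ℤ.+ b) ℤ.* + 1 ≡ (a ℤ.* + 1 ℤ.+ b ℤ.* + 1) ℤ.* + 1
  numerators = ℤ-Solver.solve-∀

ι-* : ∀ m n → ι (m ℕ.* n) ≡ ι m * ι n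
ι-* m n = trans (ℚ.fromℚᵘ-cong {ιᵘ (m ℕ.* n)} {ιᵘ m ℚᵘ.* ιᵘ n}
                  (*≡* (cong (ℤ._* + 1) (ℤ.pos-* m n))))
                (fromℚᵘ-homo-* (ιᵘ m) (ιᵘ n))

ι*recip≡1 : ∀ m .{{_ : NonZero m}} → ι m * recip m ≡ 1ℚ
ι*recip≡1 (suc m) = trans (sym (fromℚᵘ-homo-* (ιᵘ (suc m)) (ℚᵘ.1/ ιᵘ (suc m))))
                          (ℚ.fromℚᵘ-cong (ℚᵘ.*-inverseʳ (ιᵘ (suc m))))

-- Unconditional, since recip 0 = 0.
recip-* : ∀ m n → recip (m ℕ.* n) ≡ recip m * recip n
recip-* zero    n       = sym (ℚ.*-zeroˡ (recip n))
recip-* (suc m) zero    = trans (cong recip (ℕ.*-zeroʳ m)) (sym (ℚ.*-zeroʳ (recip (suc m))))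
recip-* (suc m) (suc n) = fromℚᵘ-homo-* (mkℚᵘ (+ 1) m) (mkℚᵘ (+ 1) n)

recip*[ι*x]≡x : ∀ m .{{_ : NonZero m}} x → recip m * (ι m * x) ≡ x
recip*[ι*x]≡x m x = begin
  recip m * (ι m * x)  ≡⟨ sym (ℚ.*-assoc (recip m) (ι m) x) ⟩
  recip m * ι m * x    ≡⟨ cong (_* x) (trans (ℚ.*-comm (recip m) (ι m)) (ι*recip≡1 m)) ⟩
  1ℚ * x               ≡⟨ ℚ.*-identityˡ x ⟩
  x                    ∎

recip-partial-fraction : ∀ m t →
  ι t * (recip (suc m) * recip (suc m ℕ.+ t)) ≡ recip (suc m) - recip (suc m ℕ.+ t)
recip-partial-fraction m t = begin
  ι t * (u * v)                          ≡⟨ expand (ι (suc m)) (ι t) u v ⟩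
  (ι (suc m) + ι t) * v * u - ι (suc m) * u * v
    ≡⟨ cong₂ (λ p q → p * u - q * v)
         (trans (cong (_* v) (sym (ι-+ (suc m) t))) (ι*recip≡1 (suc m ℕ.+ t)))
         (ι*recip≡1 (suc m)) ⟩
  1ℚ * u - 1ℚ * v                        ≡⟨ cong₂ _-_ (ℚ.*-identityˡ u) (ℚ.*-identityˡ v) ⟩
  u - v                                  ∎
  where
  u v : ℚ
  u = recip (suc m)
  v = recip (suc m ℕ.+ t)
  expand : ∀ a t u v → t * (u * v) ≡ (a + t) * v * u - a * u * v
  expand = solve-∀ ℚ-ring

Σ₁-cong : ∀ n {f g : ℕ → ℚ} → (∀ k → f (suc k) ≡ g (suc k)) → Σ₁ n f ≡ Σ₁ n g
Σ₁-cong zero    f≗g = refl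
Σ₁-cong (suc n) f≗g = cong₂ _+_ (Σ₁-cong n f≗g) (f≗g n)

Σ₁-distrib-+ : ∀ n (f g : ℕ → ℚ) → Σ₁ n (λ k → f k + g k) ≡ Σ₁ n f + Σ₁ n g
Σ₁-distrib-+ zero    f g = sym (ℚ.+-identityˡ 0ℚ)
Σ₁-distrib-+ (suc n) f g = begin
  Σ₁ n (λ k → f k + g k) + (f (suc n) + g (suc n))
    ≡⟨ cong (_+ (f (suc n) + g (suc n))) (Σ₁-distrib-+ n f g) ⟩
  Σ₁ n f + Σ₁ n g + (f (suc n) + g (suc n))
    ≡⟨ +-interchange (Σ₁ n f) (Σ₁ n g) (f (suc n)) (g (suc n)) ⟩
  Σ₁ n f + f (suc n) + (Σ₁ n g + g (suc n))   ∎

Σ₁-*ˡ : ∀ n c (f : ℕ → ℚ) → Σ₁ n (λ k → c * f k) ≡ c * Σ₁ n f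
Σ₁-*ˡ zero    c f = sym (ℚ.*-zeroʳ c)
Σ₁-*ˡ (suc n) c f = begin
  Σ₁ n (λ k → c * f k) + c * f (suc n)  ≡⟨ cong (_+ c * f (suc n)) (Σ₁-*ˡ n c f) ⟩
  c * Σ₁ n f + c * f (suc n)            ≡⟨ sym (ℚ.*-distribˡ-+ c (Σ₁ n f) (f (suc n))) ⟩
  c * (Σ₁ n f + f (suc n))              ∎

Σ₁-partial-fractions : ∀ t n →
  ι t * Σ₁ n (λ k → recip k * recip (k ℕ.+ t)) ≡ H n + H t - H (n ℕ.+ t)
Σ₁-partial-fractions t zero    = base (ι t) (H t)
  where
  base : ∀ c x → c * 0ℚ ≡ 0ℚ + x - x
  base = solve-∀ ℚ-ring
Σ₁-partial-fractions t (suc n) = begin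
  ι t * (S + u * v)                       ≡⟨ ℚ.*-distribˡ-+ (ι t) S (u * v) ⟩
  ι t * S + ι t * (u * v)
    ≡⟨ cong₂ _+_ (Σ₁-partial-fractions t n) (recip-partial-fraction n t) ⟩
  (H n + H t - H (n ℕ.+ t)) + (u - v)     ≡⟨ regroup (H n) (H t) (H (n ℕ.+ t)) u v ⟩
  (H n + u) + H t - (H (n ℕ.+ t) + v)     ∎
  where
  S u v : ℚ
  S = Σ₁ n (λ k → recip k * recip (k ℕ.+ t))
  u = recip (suc n)
  v = recip (suc n ℕ.+ t)
  regroup : ∀ a b c u v → (a + b - c) + (u - v) ≡ (a + u) + b - (c + v)
  regroup = solve-∀ ℚ-ring

2*Σ₁-H*recip : ∀ n → ι 2 * Σ₁ n (λ k → H k * recip k) ≡ H n * H n + H2 n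
2*Σ₁-H*recip zero    = ℚ.*-zeroʳ (ι 2)
2*Σ₁-H*recip (suc n) = begin
  ι 2 * (S + (H n + u) * u)          ≡⟨ ℚ.*-distribˡ-+ (ι 2) S ((H n + u) * u) ⟩
  ι 2 * S + ι 2 * ((H n + u) * u)    ≡⟨ cong (_+ ι 2 * ((H n + u) * u)) (2*Σ₁-H*recip n) ⟩
  H n * H n + H2 n + ι 2 * ((H n + u) * u)
                                     ≡⟨ square-step (H n) (H2 n) u ⟩
  (H n + u) * (H n + u) + (H2 n + u * u) ∎
  where
  S u : ℚ
  S = Σ₁ n (λ k → H k * recip k)
  u = recip (suc n)
  square-step : ∀ a b u → a * a + b + ι 2 * ((a + u) * u) ≡ (a + u) * (a + u) + (b + u * u)
  square-step = solve-∀ ℚ-ring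

Σ₁-H*recip : ∀ n → Σ₁ n (λ k → H k * recip k) ≡ (H n * H n + H2 n) * recip 2
Σ₁-H*recip n = begin
  S                             ≡⟨ sym (recip*[ι*x]≡x 2 S) ⟩
  recip 2 * (ι 2 * S)           ≡⟨ cong (recip 2 *_) (2*Σ₁-H*recip n) ⟩
  recip 2 * (H n * H n + H2 n)  ≡⟨ ℚ.*-comm (recip 2) (H n * H n + H2 n) ⟩
  (H n * H n + H2 n) * recip 2  ∎
  where
  S : ℚ
  S = Σ₁ n (λ k → H k * recip k)

rising-suc : ∀ k s → rising k (suc s) ≡ k ℕ.* rising (suc k) s
rising-suc k zero    =
  trans (ℕ.*-identityˡ (k ℕ.+ 0)) (trans (ℕ.+-identityʳ k) (sym (ℕ.*-identityʳ k)))
rising-suc k (suc s) = begin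
  rising k (suc s) ℕ.* (k ℕ.+ suc s)        ≡⟨ cong₂ ℕ._*_ (rising-suc k s) (ℕ.+-suc k s) ⟩
  k ℕ.* rising (suc k) s ℕ.* suc (k ℕ.+ s)  ≡⟨ ℕ.*-assoc k (rising (suc k) s) (suc (k ℕ.+ s)) ⟩
  k ℕ.* rising (suc k) (suc s)              ∎

rising-nonZero : ∀ k s → NonZero (rising (suc k) s)
rising-nonZero k zero    = _
rising-nonZero k (suc s) = ℕ.m*n≢0 (rising (suc k) s) (suc k ℕ.+ s) {{rising-nonZero k s}}

b[D-x]+aD≡[b+a][D+y-x] : ∀ a b x y D → a * x ≡ 1ℚ → (b + a) * y ≡ 1ℚ →
  b * (D - x) + a * D ≡ (b + a) * (D + y - x)
b[D-x]+aD≡[b+a][D+y-x] a b x y D ax≡1 [b+a]y≡1 = begin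
  b * (D - x) + a * D                          ≡⟨ expand a b x y D ⟩
  (b + a) * (D + y - x) + a * x - (b + a) * y
    ≡⟨ cong₂ (λ p q → (b + a) * (D + y - x) + p - q) ax≡1 [b+a]y≡1 ⟩
  (b + a) * (D + y - x) + 1ℚ - 1ℚ              ≡⟨ cancel ((b + a) * (D + y - x)) ⟩
  (b + a) * (D + y - x)                        ∎
  where
  expand : ∀ a b x y D → b * (D - x) + a * D ≡ (b + a) * (D + y - x) + a * x - (b + a) * y
  expand = solve-∀ ℚ-ring
  cancel : ∀ p → p + 1ℚ - 1ℚ ≡ p
  cancel = solve-∀ ℚ-ring

hyperharmonic-closed-form : ∀ s k →
  ι (s !) * h (suc s) k ≡ ι (rising (suc k) s) * (H (k ℕ.+ s) - H s)
hyperharmonic-closed-form zero    k       = begin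
  ι 1 * H k              ≡⟨ cong (ι 1 *_) (sym (ℚ.+-identityʳ (H k))) ⟩
  ι 1 * (H k - 0ℚ)       ≡⟨ cong (λ m → ι 1 * (H m - 0ℚ)) (sym (ℕ.+-identityʳ k)) ⟩
  ι 1 * (H (k ℕ.+ 0) - 0ℚ) ∎
hyperharmonic-closed-form (suc s) zero    = begin
  ι (suc s !) * 0ℚ                        ≡⟨ ℚ.*-zeroʳ (ι (suc s !)) ⟩
  0ℚ                                      ≡⟨ sym (ℚ.*-zeroʳ (ι R)) ⟩
  ι R * 0ℚ                                ≡⟨ cong (ι R *_) (sym (ℚ.+-inverseʳ (H (suc s)))) ⟩
  ι R * (H (suc s) - H (suc s))           ∎
  where
  R : ℕ
  R = rising 1 (suc s)
hyperharmonic-closed-form (suc s) (suc k) = begin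
  ι (suc s !) * (h (suc (suc s)) k + h (suc s) (suc k))
    ≡⟨ ℚ.*-distribˡ-+ (ι (suc s !)) (h (suc (suc s)) k) (h (suc s) (suc k)) ⟩
  ι (suc s !) * h (suc (suc s)) k + ι (suc s !) * h (suc s) (suc k)
    ≡⟨ cong₂ _+_ (hyperharmonic-closed-form (suc s) k)
                 (trans [s+1]!*h (cong (a *_) (hyperharmonic-closed-form s (suc k)))) ⟩
  ι (rising (suc k) (suc s)) * (A - (H s + x)) + a * (ι R * (H (suc k ℕ.+ s) - H s))
    ≡⟨ cong₂ (λ p i → p * (A - (H s + x)) + a * (ι R * (H i - H s)))
             ι-rising-left (sym (ℕ.+-suc k s)) ⟩
  b * ι R * (A - (H s + x)) + a * (ι R * D)   ≡⟨ factor (ι R) a b x A (H s) ⟩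
  ι R * (b * (D - x) + a * D)
    ≡⟨ cong (ι R *_) (b[D-x]+aD≡[b+a][D+y-x] a b x y D (ι*recip≡1 (suc s))
                        (trans (cong (_* y) (sym (ι-+ (suc k) (suc s)))) (ι*recip≡1 (suc m)))) ⟩
  ι R * ((b + a) * (D + y - x))               ≡⟨ regroup (ι R) (b + a) x y A (H s) ⟩
  ι R * (b + a) * ((A + y) - (H s + x))
    ≡⟨ cong (_* ((A + y) - (H s + x))) (sym ι-rising-right) ⟩
  ι (rising (suc (suc k)) (suc s)) * (H (suc m) - H (suc s)) ∎
  where
  m R : ℕ
  m = k ℕ.+ suc s
  R = rising (suc (suc k)) s
  a b x y A D : ℚ
  a = ι (suc s)
  b = ι (suc k)
  x = recip (suc s)
  y = recip (suc m)
  A = H m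
  D = A - H s
  [s+1]!*h : ι (suc s !) * h (suc s) (suc k) ≡ a * (ι (s !) * h (suc s) (suc k))
  [s+1]!*h = trans (cong (_* h (suc s) (suc k)) (ι-* (suc s) (s !)))
                   (ℚ.*-assoc a (ι (s !)) (h (suc s) (suc k)))
  ι-rising-left : ι (rising (suc k) (suc s)) ≡ b * ι R
  ι-rising-left = trans (cong ι (rising-suc (suc k) s)) (ι-* (suc k) R)
  ι-rising-right : ι (rising (suc (suc k)) (suc s)) ≡ ι R * (b + a)
  ι-rising-right = begin
    ι (R ℕ.* suc (suc k ℕ.+ s))  ≡⟨ cong (λ i → ι (R ℕ.* suc i)) (sym (ℕ.+-suc k s)) ⟩
    ι (R ℕ.* suc m)              ≡⟨ ι-* R (suc m) ⟩
    ι R * ι (suc k ℕ.+ suc s)    ≡⟨ cong (ι R *_) (ι-+ (suc k) (suc s)) ⟩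
    ι R * (b + a)                ∎
  factor : ∀ r a b x A h →
    b * r * (A - (h + x)) + a * (r * (A - h)) ≡ r * (b * ((A - h) - x) + a * (A - h))
  factor = solve-∀ ℚ-ring
  regroup : ∀ r c x y A h → r * (c * ((A - h) + y - x)) ≡ r * c * ((A + y) - (h + x))
  regroup = solve-∀ ℚ-ring

hyperharmonic-summand : ∀ s k →
  ι (s !) * (h (suc s) k * recip (rising k (suc s))) ≡ (H (k ℕ.+ s) - H s) * recip k
hyperharmonic-summand s k = begin
  ι (s !) * (h (suc s) k * recip (rising k (suc s)))
    ≡⟨ cong (λ p → ι (s !) * (h (suc s) k * recip p)) (rising-suc k s) ⟩
  ι (s !) * (h (suc s) k * recip (k ℕ.* R))
    ≡⟨ cong (λ p → ι (s !) * (h (suc s) k * p)) (recip-* k R) ⟩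
  ι (s !) * (h (suc s) k * (recip k * recip R))
    ≡⟨ sym (ℚ.*-assoc (ι (s !)) (h (suc s) k) (recip k * recip R)) ⟩
  ι (s !) * h (suc s) k * (recip k * recip R)
    ≡⟨ cong (_* (recip k * recip R)) (hyperharmonic-closed-form s k) ⟩
  ι R * D * (recip k * recip R)                 ≡⟨ rearrange (ι R) D (recip k) (recip R) ⟩
  D * recip k * (ι R * recip R)
    ≡⟨ cong (D * recip k *_) (ι*recip≡1 R {{rising-nonZero k s}}) ⟩
  D * recip k * 1ℚ                              ≡⟨ ℚ.*-identityʳ (D * recip k) ⟩
  D * recip k                                   ∎
  where
  R : ℕ
  R = rising (suc k) s
  D : ℚ
  D = H (k ℕ.+ s) - H s
  rearrange : ∀ r d u v → r * d * (u * v) ≡ d * u * (r * v)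
  rearrange = solve-∀ ℚ-ring

Σ₁-hyperharmonic-summands : ∀ s n →
  ι (s !) * Σ₁ n (λ k → h (suc s) k * recip (rising k (suc s)))
    ≡ Σ₁ n (λ k → H (k ℕ.+ s) * recip k) - H s * H n
Σ₁-hyperharmonic-summands s n = begin
  ι (s !) * Σ₁ n (λ k → h (suc s) k * recip (rising k (suc s)))
    ≡⟨ sym (Σ₁-*ˡ n (ι (s !)) (λ k → h (suc s) k * recip (rising k (suc s)))) ⟩
  Σ₁ n (λ k → ι (s !) * (h (suc s) k * recip (rising k (suc s))))
    ≡⟨ Σ₁-cong n (λ k → hyperharmonic-summand s (suc k)) ⟩
  Σ₁ n (λ k → (H (k ℕ.+ s) - H s) * recip k)
    ≡⟨ Σ₁-cong n (λ k → ℚ.*-distribʳ-+ (recip (suc k)) (H (suc k ℕ.+ s)) (- H s)) ⟩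
  Σ₁ n (λ k → H (k ℕ.+ s) * recip k + - H s * recip k)
    ≡⟨ Σ₁-distrib-+ n (λ k → H (k ℕ.+ s) * recip k) (λ k → - H s * recip k) ⟩
  Σ₁ n (λ k → H (k ℕ.+ s) * recip k) + Σ₁ n (λ k → - H s * recip k)
    ≡⟨ cong (λ q → Σ₁ n (λ k → H (k ℕ.+ s) * recip k) + q)
         (trans (Σ₁-*ˡ n (- H s) recip) (sym (ℚ.neg-distribˡ-* (H s) (H n)))) ⟩
  Σ₁ n (λ k → H (k ℕ.+ s) * recip k) - H s * H n ∎

Σ₁-shifted-H*recip : ∀ s n →
  Σ₁ n (λ k → H (k ℕ.+ s) * recip k)
    ≡ (H n * H n + H2 n) * recip 2
      + Σ₁ s (λ j → H j * recip j)
      + Σ₁ s (λ j → H (j ℕ.∸ 1) * recip (j ℕ.+ n))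
      - H s * (H (n ℕ.+ s) - H n)
Σ₁-shifted-H*recip zero    n = begin
  Σ₁ n (λ k → H (k ℕ.+ 0) * recip k)
    ≡⟨ Σ₁-cong n (λ k → cong (λ j → H j * recip (suc k)) (ℕ.+-identityʳ (suc k))) ⟩
  Σ₁ n (λ k → H k * recip k)         ≡⟨ Σ₁-H*recip n ⟩
  (H n * H n + H2 n) * recip 2       ≡⟨ pad ((H n * H n + H2 n) * recip 2) (H (n ℕ.+ 0) - H n) ⟩
  (H n * H n + H2 n) * recip 2 + 0ℚ + 0ℚ - 0ℚ * (H (n ℕ.+ 0) - H n) ∎
  where
  pad : ∀ y d → y ≡ y + 0ℚ + 0ℚ - 0ℚ * d
  pad = solve-∀ ℚ-ring
Σ₁-shifted-H*recip (suc s) n = begin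
  Σ₁ n (λ k → H (k ℕ.+ suc s) * recip k)
    ≡⟨ Σ₁-cong n split ⟩
  Σ₁ n (λ k → H (k ℕ.+ s) * recip k + recip k * recip (k ℕ.+ suc s))
    ≡⟨ Σ₁-distrib-+ n (λ k → H (k ℕ.+ s) * recip k) (λ k → recip k * recip (k ℕ.+ suc s)) ⟩
  Σ₁ n (λ k → H (k ℕ.+ s) * recip k) + T
    ≡⟨ cong₂ _+_ (Σ₁-shifted-H*recip s n) T-by-partial-fractions ⟩
  Y + P + Q - H s * (H (n ℕ.+ s) - H n) + x * (H n + (H s + x) - H (n ℕ.+ suc s))
    ≡⟨ cong (λ j → Y + P + Q - H s * (H (n ℕ.+ s) - H n) + x * (H n + (H s + x) - H j))
         (ℕ.+-suc n s) ⟩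
  Y + P + Q - H s * (H (n ℕ.+ s) - H n) + x * (H n + (H s + x) - (H (n ℕ.+ s) + z))
    ≡⟨ step Y P Q (H s) (H n) (H (n ℕ.+ s)) x z ⟩
  Y + (P + (H s + x) * x) + (Q + H s * z) - (H s + x) * (H (suc (n ℕ.+ s)) - H n)
    ≡⟨ cong₂ (λ i j → Y + (P + (H s + x) * x) + (Q + H s * recip (suc i)) - (H s + x) * (H j - H n))
         (ℕ.+-comm n s) (sym (ℕ.+-suc n s)) ⟩
  Y + (P + (H s + x) * x) + (Q + H s * recip (suc s ℕ.+ n)) - (H s + x) * (H (n ℕ.+ suc s) - H n) ∎
  where
  Y P Q T x z : ℚ
  Y = (H n * H n + H2 n) * recip 2
  P = Σ₁ s (λ j → H j * recip j)
  Q = Σ₁ s (λ j → H (j ℕ.∸ 1) * recip (j ℕ.+ n))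
  T = Σ₁ n (λ k → recip k * recip (k ℕ.+ suc s))
  x = recip (suc s)
  z = recip (suc (n ℕ.+ s))
  split : ∀ k → H (suc k ℕ.+ suc s) * recip (suc k)
              ≡ H (suc k ℕ.+ s) * recip (suc k) + recip (suc k) * recip (suc k ℕ.+ suc s)
  split k = begin
    (H (k ℕ.+ suc s) + recip (suc (k ℕ.+ suc s))) * recip (suc k)
      ≡⟨ ℚ.*-distribʳ-+ (recip (suc k)) (H (k ℕ.+ suc s)) (recip (suc (k ℕ.+ suc s))) ⟩
    H (k ℕ.+ suc s) * recip (suc k) + recip (suc (k ℕ.+ suc s)) * recip (suc k)
      ≡⟨ cong₂ (λ i q → H i * recip (suc k) + q) (ℕ.+-suc k s)
           (ℚ.*-comm (recip (suc (k ℕ.+ suc s))) (recip (suc k))) ⟩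
    H (suc k ℕ.+ s) * recip (suc k) + recip (suc k) * recip (suc k ℕ.+ suc s) ∎
  T-by-partial-fractions : T ≡ x * (H n + (H s + x) - H (n ℕ.+ suc s))
  T-by-partial-fractions =
    trans (sym (recip*[ι*x]≡x (suc s) T)) (cong (x *_) (Σ₁-partial-fractions (suc s) n))
  step : ∀ Y P Q h hₙ hₙₛ x z →
    Y + P + Q - h * (hₙₛ - hₙ) + x * (hₙ + (h + x) - (hₙₛ + z))
      ≡ Y + (P + (h + x) * x) + (Q + h * z) - (h + x) * ((hₙₛ + z) - hₙ)
  step = solve-∀ ℚ-ring

lemma5 : (r n : ℕ) → 1 ≤ r → 1 ≤ n →
    Γℕ r * Σ₁ n (λ k → h r k * recip (rising k r))
      ≡ (H n * H n + H2 n) * recip 2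
        - H (r ℕ.∸ 1) * (H (n ℕ.+ r ℕ.∸ 1) - H n)
        - ψ+γ r * H n
        + Σ₁ (r ℕ.∸ 1) (λ j → H j * recip j)
        + Σ₁ (r ℕ.∸ 1) (λ j → H (j ℕ.∸ 1) * recip (j ℕ.+ n))
lemma5 zero    n () _
lemma5 (suc s) n _ _ = begin
  ι (s !) * Σ₁ n (λ k → h (suc s) k * recip (rising k (suc s)))
    ≡⟨ Σ₁-hyperharmonic-summands s n ⟩
  Σ₁ n (λ k → H (k ℕ.+ s) * recip k) - H s * H n
    ≡⟨ cong (_- H s * H n) (Σ₁-shifted-H*recip s n) ⟩
  Y + P + Q - H s * (H (n ℕ.+ s) - H n) - H s * H n
    ≡⟨ rearrange Y P Q (H s * (H (n ℕ.+ s) - H n)) (H s * H n) ⟩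
  Y - H s * (H (n ℕ.+ s) - H n) - H s * H n + P + Q
    ≡⟨ cong (λ j → Y - H s * (H (j ℕ.∸ 1) - H n) - H s * H n + P + Q) (sym (ℕ.+-suc n s)) ⟩
  Y - H s * (H (n ℕ.+ suc s ℕ.∸ 1) - H n) - H s * H n + P + Q ∎
  where
  Y P Q : ℚ
  Y = (H n * H n + H2 n) * recip 2
  P = Σ₁ s (λ j → H j * recip j)
  Q = Σ₁ s (λ j → H (j ℕ.∸ 1) * recip (j ℕ.+ n))
  rearrange : ∀ Y P Q u v → Y + P + Q - u - v ≡ Y - u - v + P + Q
  rearrange = solve-∀ ℚ-ring
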